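{- The class of complete multipartite graphs is intersectionwise self-$\chi$-guarding.
   Context: All graphs are finite and simple. A graph is complete multipartite if its vertex set can be partitioned into nonempty independent sets pairwise complete to each other. The $k$-fold graph-intersection of a class $\mathcal{A}$ is the class of all graphs $(\bigcap_{i\in[k]}V(G_i),\bigcap_{i\in[k]}E(G_i))$ with $G_1,\dots,G_k\in\mathcal{A}$. A class is $\chi$-bounded if there is a non-decreasing $f:\mathbb{N}\to\mathbb{N}$ with $\chi(G)\le f(\omega(G))$ for all members. A class $\mathcal{A}$ is intersectionwise self-$\chi$-guarding if for every positive integer $k$ the $k$-fold graph-intersection of $\mathcal{A}$ is $\chi$-bounded. -}

module Defs where

open import Data.Nat using (ℕ; _<_; _≤_)
open import Data.Bool using (Bool; true; false; _∧_)
open import Data.Bool.Properties using (∧-comm)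
open import Data.Fin using (Fin; zero; suc)
open import Data.Product using (Σ; _×_; _,_; ∃)
open import Relation.Binary.PropositionalEquality using (_≡_; _≢_)
open import Relation.Nullary using (¬_)

-- A finite simple graph whose vertices are natural numbers (labels drawn
-- from a common universe ℕ, so that intersections make sense).
record Graph : Set where
  field
    V       : ℕ → Bool
    bound   : ℕ
    finite  : ∀ x → V x ≡ true → x < bound
    E       : ℕ → ℕ → Bool
    E-sym   : ∀ x y → E x y ≡ E y x
    E-irr   : ∀ x → E x x ≡ false
    E⊆V     : ∀ x y → E x y ≡ true → V x ≡ true
open Graph public

private
  ∧-trueˡ : ∀ {a b} → a ∧ b ≡ true → a ≡ true
  ∧-trueˡ {true} _ = _≡_.refl

  ∧-false : ∀ {a} b → a ≡ false → a ∧ b ≡ false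
  ∧-false b _≡_.refl = _≡_.refl

_∩ᴳ_ : Graph → Graph → Graph
G ∩ᴳ H = record
  { V      = λ x → V G x ∧ V H x
  ; bound  = bound G
  ; finite = λ x p → finite G x (∧-trueˡ p)
  ; E      = λ x y → E G x y ∧ E H x y
  ; E-sym  = λ x y → Relation.Binary.PropositionalEquality.cong₂ _∧_ (E-sym G x y) (E-sym H x y)
  ; E-irr  = λ x → ∧-false (E H x x) (E-irr G x)
  ; E⊆V    = λ x y p → vh x y p
  }
  where
  open import Relation.Binary.PropositionalEquality using (cong₂)
  vh : ∀ x y → E G x y ∧ E H x y ≡ true → V G x ∧ V H x ≡ true
  vh x y p with E G x y | E H x y | E⊆V G x y | E⊆V H x y
  ... | true | true | f | g rewrite f _≡_.refl | g _≡_.refl = _≡_.refl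

⋂ᴳ : ∀ {m} → (Fin (ℕ.suc m) → Graph) → Graph
⋂ᴳ {ℕ.zero}  Gs = Gs zero
⋂ᴳ {ℕ.suc m} Gs = Gs zero ∩ᴳ ⋂ᴳ (λ i → Gs (suc i))

_≅ᴳ_ : Graph → Graph → Set
G ≅ᴳ H = (∀ x → V G x ≡ V H x) × (∀ x y → E G x y ≡ E H x y)

GraphClass : Set₁
GraphClass = Graph → Set

-- The k-fold graph-intersection of a class A, for k = suc m.
KFoldIntersection : GraphClass → ℕ → GraphClass
KFoldIntersection A m H =
  Σ (Fin (ℕ.suc m) → Graph) λ Gs → (∀ i → A (Gs i)) × (H ≅ᴳ ⋂ᴳ Gs)

HasClique : Graph → ℕ → Set
HasClique G s =
  Σ (Fin s → ℕ) λ c →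
    (∀ i → V G (c i) ≡ true) ×
    (∀ i j → i ≢ j → E G (c i) (c j) ≡ true)

IsCliqueNumber : Graph → ℕ → Set
IsCliqueNumber G w = HasClique G w × ¬ HasClique G (ℕ.suc w)

Colourable : Graph → ℕ → Set
Colourable G c =
  Σ ((x : ℕ) → V G x ≡ true → Fin c) λ col →
    ∀ x y (px : V G x ≡ true) (py : V G y ≡ true) →
      E G x y ≡ true → col x px ≢ col y py

ChiBounded : GraphClass → Set
ChiBounded C =
  Σ (ℕ → ℕ) λ f →
    (∀ m n → m ≤ n → f m ≤ f n) ×
    (∀ G → C G → ∀ w → IsCliqueNumber G w → Colourable G (f w))

CompleteMultipartite : GraphClass
CompleteMultipartite G =
  Σ (ℕ → ℕ) λ part →
    ∀ x y → V G x ≡ true → V G y ≡ true → x ≢ y →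
      (E G x y ≡ true → part x ≢ part y) × (part x ≢ part y → E G x y ≡ true)

IntersectionwiseSelfChiGuarding : GraphClass → Set
IntersectionwiseSelfChiGuarding A = ∀ m → ChiBounded (KFoldIntersection A m)

{-# OPTIONS --safe #-}
-- In a k-fold intersection of complete multipartite graphs, fix a maximum
-- clique c₁,…,c_ω. Every vertex x shares a part of some factor Gᵢ with some
-- cⱼ: otherwise x would lie in a different part from every cⱼ in every
-- factor, hence be adjacent to all of them, and extend the clique. Colouring
-- x by such a pair (j , i) is proper, because two vertices of the same
-- colour lie in the same part of Gᵢ and so are not adjacent. Thus χ ≤ k·ω.
module Submission where

open import Defs
open import Data.Nat using (ℕ; suc; _*_)
open import Data.Nat.Properties using (_≟_; *-monoˡ-≤)
open import Data.Bool using (true; _∧_)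
open import Data.Fin using (Fin; zero; suc; combine)
open import Data.Fin.Properties using (any?; combine-injective)
open import Data.Vec.Functional using (_∷_)
open import Data.Product using (∃₂; _×_; _,_; proj₁; proj₂)
open import Relation.Binary.PropositionalEquality using (_≡_; _≢_; refl; sym; trans; cong)
open import Relation.Nullary using (¬_; yes; no; contradiction)

∧-true⁻ : ∀ {a b} → a ∧ b ≡ true → a ≡ true × b ≡ true
∧-true⁻ {true} {true} _ = refl , refl

∧-true⁺ : ∀ {a b} → a ≡ true → b ≡ true → a ∧ b ≡ true
∧-true⁺ refl refl = refl

V-⋂ᴳ⁻ : ∀ {m} (Gs : Fin (suc m) → Graph) {x} →
        V (⋂ᴳ Gs) x ≡ true → ∀ i → V (Gs i) x ≡ true
V-⋂ᴳ⁻ {ℕ.zero}  Gs p zero    = p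
V-⋂ᴳ⁻ {ℕ.suc m} Gs p zero    = proj₁ (∧-true⁻ {V (Gs zero) _} p)
V-⋂ᴳ⁻ {ℕ.suc m} Gs p (suc i) = V-⋂ᴳ⁻ (λ i → Gs (suc i)) (proj₂ (∧-true⁻ {V (Gs zero) _} p)) i

E-⋂ᴳ⁻ : ∀ {m} (Gs : Fin (suc m) → Graph) {x y} →
        E (⋂ᴳ Gs) x y ≡ true → ∀ i → E (Gs i) x y ≡ true
E-⋂ᴳ⁻ {ℕ.zero}  Gs p zero    = p
E-⋂ᴳ⁻ {ℕ.suc m} Gs p zero    = proj₁ (∧-true⁻ {E (Gs zero) _ _} p)
E-⋂ᴳ⁻ {ℕ.suc m} Gs p (suc i) = E-⋂ᴳ⁻ (λ i → Gs (suc i)) (proj₂ (∧-true⁻ {E (Gs zero) _ _} p)) i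

E-⋂ᴳ⁺ : ∀ {m} (Gs : Fin (suc m) → Graph) {x y} →
        (∀ i → E (Gs i) x y ≡ true) → E (⋂ᴳ Gs) x y ≡ true
E-⋂ᴳ⁺ {ℕ.zero}  Gs p = p zero
E-⋂ᴳ⁺ {ℕ.suc m} Gs p = ∧-true⁺ (p zero) (E-⋂ᴳ⁺ (λ i → Gs (suc i)) (λ i → p (suc i)))

E⇒≢ : ∀ G {x y} → E G x y ≡ true → x ≢ y
E⇒≢ G {x} exy refl with trans (sym (E-irr G x)) exy
... | ()

IsClique : Graph → ∀ {s} → (Fin s → ℕ) → Set
IsClique G c = (∀ i → V G (c i) ≡ true) × (∀ i j → i ≢ j → E G (c i) (c j) ≡ true)

∷-isClique : ∀ G {s x} {c : Fin s → ℕ} → V G x ≡ true → (∀ j → E G x (c j) ≡ true) →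
             IsClique G c → IsClique G (x ∷ c)
∷-isClique G {x = x} {c} px x~c (cV , cE) = V-∷ , E-∷
  where
  V-∷ : ∀ i → V G ((x ∷ c) i) ≡ true
  V-∷ zero    = px
  V-∷ (suc i) = cV i

  E-∷ : ∀ i j → i ≢ j → E G ((x ∷ c) i) ((x ∷ c) j) ≡ true
  E-∷ zero    zero    i≢j = contradiction refl i≢j
  E-∷ zero    (suc j) _   = x~c j
  E-∷ (suc i) zero    _   = trans (E-sym G (c i) x) (x~c i)
  E-∷ (suc i) (suc j) i≢j = cE i j (λ i≡j → i≢j (cong suc i≡j))

-- G is the intersection of k complete multipartite graphs on V(G), the i-th
-- having the fibres of part i as its parts. `complete` needs no x ≢ y premise
-- since for k ≥ 1 it follows from part i x ≢ part i y.
record MultipartiteRepresentation (G : Graph) (k : ℕ) : Set where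
  field
    part        : Fin k → ℕ → ℕ
    independent : ∀ i {x y} → E G x y ≡ true → part i x ≢ part i y
    complete    : ∀ {x y} → V G x ≡ true → V G y ≡ true →
                  (∀ i → part i x ≢ part i y) → E G x y ≡ true

kFoldIntersection⇒multipartiteRepresentation :
  ∀ {m G} → KFoldIntersection CompleteMultipartite m G → MultipartiteRepresentation G (suc m)
kFoldIntersection⇒multipartiteRepresentation {m} {G} (Gs , multipartite , V≡ , E≡) =
  record { part = part ; independent = independent ; complete = complete }
  where
  part : Fin (suc m) → ℕ → ℕ
  part i = proj₁ (multipartite i)

  V-in : ∀ {x} → V G x ≡ true → ∀ i → V (Gs i) x ≡ true
  V-in {x} px = V-⋂ᴳ⁻ Gs (trans (sym (V≡ x)) px)

  E-in : ∀ {x y} → E G x y ≡ true → ∀ i → E (Gs i) x y ≡ true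
  E-in {x} {y} exy = E-⋂ᴳ⁻ Gs (trans (sym (E≡ x y)) exy)

  independent : ∀ i {x y} → E G x y ≡ true → part i x ≢ part i y
  independent i {x} {y} exy = proj₁ (proj₂ (multipartite i) x y px py (E⇒≢ (Gs i) exyᵢ)) exyᵢ
    where
    exyᵢ = E-in exy i
    px   = E⊆V (Gs i) x y exyᵢ
    py   = E⊆V (Gs i) y x (trans (E-sym (Gs i) y x) exyᵢ)

  complete : ∀ {x y} → V G x ≡ true → V G y ≡ true →
             (∀ i → part i x ≢ part i y) → E G x y ≡ true
  complete {x} {y} px py parts≢ = trans (E≡ x y) (E-⋂ᴳ⁺ Gs adjacentᵢ)
    where
    x≢y : x ≢ y
    x≢y refl = parts≢ zero refl

    adjacentᵢ : ∀ i → E (Gs i) x y ≡ true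
    adjacentᵢ i = proj₂ (proj₂ (multipartite i) x y (V-in px i) (V-in py i) x≢y) (parts≢ i)

module _ {G k} (R : MultipartiteRepresentation G k)
         {w} {c : Fin w → ℕ} (c-clique : IsClique G c) (maximum : ¬ HasClique G (suc w)) where
  open MultipartiteRepresentation R

  sharesPartWithClique : ∀ {x} → V G x ≡ true → ∃₂ λ j i → part i x ≡ part i (c j)
  sharesPartWithClique {x} px with any? (λ j → any? (λ i → part i x ≟ part i (c j)))
  ... | yes (j , i , same) = j , i , same
  ... | no  none           = contradiction (x ∷ c , ∷-isClique G px x~c c-clique) maximum
    where
    x~c : ∀ j → E G x (c j) ≡ true
    x~c j = complete px (proj₁ c-clique j) (λ i same → none (j , i , same))

  colour : ∀ x → V G x ≡ true → Fin (w * k)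
  colour x px with sharesPartWithClique px
  ... | j , i , _ = combine j i

  colour-proper : ∀ x y (px : V G x ≡ true) (py : V G y ≡ true) →
                  E G x y ≡ true → colour x px ≢ colour y py
  colour-proper x y px py exy same-colour with sharesPartWithClique px | sharesPartWithClique py
  ... | j , i , x∼cⱼ | j′ , i′ , y∼cⱼ′ with combine-injective j i j′ i′ same-colour
  ...   | refl , refl = independent i exy (trans x∼cⱼ (sym y∼cⱼ′))

multipartiteRepresentation⇒colourable : ∀ {G k w} → MultipartiteRepresentation G k →
                                        IsCliqueNumber G w → Colourable G (w * k)
multipartiteRepresentation⇒colourable R ((c , c-clique) , maximum) =
  colour R c-clique maximum , colour-proper R c-clique maximum

corollary6p13 : IntersectionwiseSelfChiGuarding CompleteMultipartite
corollary6p13 m =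
  (λ w → w * suc m) ,
  (λ _ _ → *-monoˡ-≤ (suc m)) ,
  (λ G G∈kFold _ ω≡w →
     multipartiteRepresentation⇒colourable
       (kFoldIntersection⇒multipartiteRepresentation {m} {G} G∈kFold) ω≡w)
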